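{- Let $(V,\tau)$ be a vocabulary, let $\mathbb{M}=(M,A)$ and $\mathbb{M}'=(M',A')$ be dependence models for $(V,\tau)$, and let $Z\subseteq A\times A'$ be a dependence bisimulation. Then for every $(s,s')\in Z$ and every formula $\varphi\in LFD[V,\tau]$: $\mathbb{M},s\models\varphi$ if and only if $\mathbb{M}',s'\models\varphi$.
   Context: A vocabulary $(V,\tau)$ consists of a set of variables $V$ and a relational signature $\tau$ with arity map $ar$. The language $LFD[V,\tau]$ is given by $\varphi::=P\mathbf{x}\mid\neg\varphi\mid\varphi\wedge\varphi\mid\mathbb{D}_X\varphi\mid D_Xy$, where $X\subseteq V$ is finite, $y\in V$, $P\in\tau$ and $\mathbf{x}\in V^{ar(P)}$. A dependence model for $(V,\tau)$ is a pair $(M,A)$ where $M$ is a $\tau$-structure with domain $O$ and $A\subseteq O^V$ is a set of assignments (the team). For $X\subseteq V$ and $s,t\in A$, write $s=_Xt$ iff $s\restriction X=t\restriction X$ (and $s=_yt$ for $s=_{\{y\}}t$). Truth at $s\in A$: $s\models P\mathbf{x}$ iff $(s(x_1),\dots,s(x_n))\in P^M$; Booleans as usual; $s\models\mathbb{D}_X\varphi$ iff $t\models\varphi$ for all $t\in A$ with $s=_Xt$; $s\models D_Xy$ iff for all $t\in A$, $s=_Xt$ implies $s=_yt$ (this clause makes sense for any $X\subseteq V$). For $s,t\in A$ let $V^{s,t}=\{v\in V\mid s(v)=t(v)\}$. A set $X\subseteq V$ is dependence-closed at an assignment $s'$ if $s'\models D_Xy$ implies $y\in X$ for all $y\in V$.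 A non-empty relation $Z\subseteq A\times A'$ is a dependence bisimulation if for every $(s,s')\in Z$: (Atom) $s\models P\mathbf{x}$ iff $s'\models P\mathbf{x}$ for all $P\in\tau$ and $\mathbf{x}\in V^{ar(P)}$; (Forth) for every $t\in A$, the set $V^{s,t}$ is dependence-closed at $s'$ and there is $t'\in A'$ with $s'=_{V^{s,t}}t'$ and $(t,t')\in Z$; (Back) for every $t'\in A'$, the set $V^{s',t'}$ is dependence-closed at $s$ and there is $t\in A$ with $s=_{V^{s',t'}}t$ and $(t,t')\in Z$. -}

module Defs where

open import Data.Nat using (ℕ)
open import Data.Vec using (Vec; map)
open import Data.List using (List)
open import Data.List.Membership.Propositional using (_∈_)
open import Data.Product using (Σ; _×_; _,_)
open import Relation.Nullary using (¬_)
open import Relation.Binary.PropositionalEquality using (_≡_)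

record Vocabulary : Set₁ where
  field
    Var  : Set
    Pred : Set
    ar   : Pred → ℕ
open Vocabulary public

-- Formulas of LFD[V,τ]. Finite sets X ⊆ V are represented by lists.
data Formula (voc : Vocabulary) : Set where
  atom : (P : Pred voc) → Vec (Var voc) (ar voc P) → Formula voc
  neg  : Formula voc → Formula voc
  conj : Formula voc → Formula voc → Formula voc
  𝔻    : List (Var voc) → Formula voc → Formula voc
  Dep  : List (Var voc) → Var voc → Formula voc

record Structure (voc : Vocabulary) : Set₁ where
  field
    Dom    : Set
    interp : (P : Pred voc) → Vec Dom (ar voc P) → Set
open Structure public

Assignment : (voc : Vocabulary) → Set → Set
Assignment voc O = Var voc → O

record DepModel (voc : Vocabulary) : Set₁ where
  field
    struct : Structure voc
    team   : Assignment voc (Dom struct) → Set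
open DepModel public

module _ {voc : Vocabulary} (𝕄 : DepModel voc) where
  O : Set
  O = Dom (struct 𝕄)

  Elem : Set
  Elem = Σ (Assignment voc O) (team 𝕄)

  agreeOn : (Var voc → Set) → Elem → Elem → Set
  agreeOn X (s , _) (t , _) = ∀ x → X x → s x ≡ t x

  agreeOnL : List (Var voc) → Elem → Elem → Set
  agreeOnL X = agreeOn (λ x → x ∈ X)

  DepAt : (Var voc → Set) → Var voc → Elem → Set
  DepAt X y s = ∀ t → agreeOn X s t → proj s y ≡ proj t y
    where
    proj : Elem → Var voc → O
    proj (u , _) = u

  Vst : Elem → Elem → Var voc → Set
  Vst (s , _) (t , _) v = s v ≡ t v

  DepClosed : (Var voc → Set) → Elem → Set
  DepClosed X s = ∀ y → DepAt X y s → X y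

  _⊨_ : Elem → Formula voc → Set
  (s , _) ⊨ atom P xs = interp (struct 𝕄) P (map s xs)
  s ⊨ neg φ = ¬ (s ⊨ φ)
  s ⊨ conj φ ψ = (s ⊨ φ) × (s ⊨ ψ)
  s ⊨ 𝔻 X φ = ∀ t → agreeOnL X s t → t ⊨ φ
  s ⊨ Dep X y = DepAt (λ x → x ∈ X) y s

record IsDepBisim {voc : Vocabulary} (𝕄 𝕄' : DepModel voc)
                  (Z : Elem 𝕄 → Elem 𝕄' → Set) : Set₁ where
  field
    nonempty : Σ (Elem 𝕄) (λ s → Σ (Elem 𝕄') (λ s' → Z s s'))
    atomCond : ∀ s s' → Z s s' → (P : Pred voc) (xs : Vec (Var voc) (ar voc P)) →
               (_⊨_ 𝕄 s (atom P xs) → _⊨_ 𝕄' s' (atom P xs)) ×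
               (_⊨_ 𝕄' s' (atom P xs) → _⊨_ 𝕄 s (atom P xs))
    forth : ∀ s s' → Z s s' → ∀ t →
            DepClosed 𝕄' (Vst 𝕄 s t) s' ×
            Σ (Elem 𝕄') (λ t' → agreeOn 𝕄' (Vst 𝕄 s t) s' t' × Z t t')
    back  : ∀ s s' → Z s s' → ∀ t' →
            DepClosed 𝕄 (Vst 𝕄' s' t') s ×
            Σ (Elem 𝕄) (λ t → agreeOn 𝕄 (Vst 𝕄' s' t') s t × Z t t')

module Submission where

open import Defs
open import Data.Product using (_×_; _,_; proj₁; proj₂; swap)
open import Function using (flip; _∘′_)
open import Relation.Unary using (_⊆_)

-- The clauses of a dependence bisimulation are symmetric, so the
-- forth half of each modal case is the back half for the converse bisimulation.
-- In both modal cases s' =_X t' says exactly X ⊆ V^{s',t'}: for 𝔻_X the back clause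
-- gives a Z-partner t of t' with s =_X t; for D_X y, dependence on X lifts to
-- dependence on V^{s',t'} at s, whose dependence-closedness puts y in V^{s',t'}.

module _ {voc : Vocabulary} (𝕄 : DepModel voc) where

  agreeOn-antitone : ∀ {X Y : Var voc → Set} {s t : Elem 𝕄} →
                     X ⊆ Y → agreeOn 𝕄 Y s t → agreeOn 𝕄 X s t
  agreeOn-antitone X⊆Y s=t x x∈X = s=t x (X⊆Y {x} x∈X)

  DepAt-monotone : ∀ {X Y : Var voc → Set} {y : Var voc} {s : Elem 𝕄} →
                   X ⊆ Y → DepAt 𝕄 X y s → DepAt 𝕄 Y y s
  DepAt-monotone {s = s} X⊆Y dep t s=t = dep t (agreeOn-antitone {s = s} {t} X⊆Y s=t)

module _ {voc : Vocabulary} {𝕄 𝕄' : DepModel voc} {Z : Elem 𝕄 → Elem 𝕄' → Set} where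

  converse : IsDepBisim 𝕄 𝕄' Z → IsDepBisim 𝕄' 𝕄 (flip Z)
  converse B = record
    { nonempty = let (s , s' , z) = nonempty in s' , s , z
    ; atomCond = λ s' s z P xs → swap (atomCond s s' z P xs)
    ; forth    = λ s' s z → back s s' z
    ; back     = λ s' s z → forth s s' z
    }
    where open IsDepBisim B

  module _ (B : IsDepBisim 𝕄 𝕄' Z) where
    open IsDepBisim B

    𝔻-back : ∀ φ {X s s'} → (∀ t t' → Z t t' → _⊨_ 𝕄 t φ → _⊨_ 𝕄' t' φ) →
             Z s s' → _⊨_ 𝕄 s (𝔻 X φ) → _⊨_ 𝕄' s' (𝔻 X φ)
    𝔻-back φ {s = s} {s'} preserves z sat t' s'=t' =
      let (_ , t , s=t , zt) = back s s' z t'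
      in  preserves t t' zt (sat t (agreeOn-antitone 𝕄 {s = s} {t} (λ {x} → s'=t' x) s=t))

    Dep-back : ∀ X y {s s'} → Z s s' → _⊨_ 𝕄 s (Dep X y) → _⊨_ 𝕄' s' (Dep X y)
    Dep-back X y {s} {s'} z dep t' s'=t' =
      proj₁ (back s s' z t') _ (DepAt-monotone 𝕄 {s = s} (λ {x} → s'=t' x) dep)

module _ {voc : Vocabulary} {𝕄 𝕄' : DepModel voc} {Z : Elem 𝕄 → Elem 𝕄' → Set}
         (B : IsDepBisim 𝕄 𝕄' Z) where
  open IsDepBisim B using (atomCond)

  invariance : ∀ s s' → Z s s' → (φ : Formula voc) →
               (_⊨_ 𝕄 s φ → _⊨_ 𝕄' s' φ) × (_⊨_ 𝕄' s' φ → _⊨_ 𝕄 s φ)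
  invariance s s' z (atom P xs) = atomCond s s' z P xs
  invariance s s' z (neg φ)     =
    let (to , from) = invariance s s' z φ in (λ ¬φ → ¬φ ∘′ from) , (λ ¬φ → ¬φ ∘′ to)
  invariance s s' z (conj φ ψ)  =
    let (toφ , fromφ) = invariance s s' z φ
        (toψ , fromψ) = invariance s s' z ψ
    in  (λ (a , b) → toφ a , toψ b) , (λ (a , b) → fromφ a , fromψ b)
  invariance s s' z (𝔻 X φ)     =
      𝔻-back B φ (λ t t' zt → proj₁ (invariance t t' zt φ)) z
    , 𝔻-back (converse B) φ (λ t' t zt → proj₂ (invariance t t' zt φ)) z
  invariance s s' z (Dep X y)   = Dep-back B X y z , Dep-back (converse B) X y z

proposition3p1 : (voc : Vocabulary) (𝕄 𝕄' : DepModel voc)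
    (Z : Elem 𝕄 → Elem 𝕄' → Set) → IsDepBisim 𝕄 𝕄' Z →
    ∀ s s' → Z s s' → (φ : Formula voc) →
    (_⊨_ 𝕄 s φ → _⊨_ 𝕄' s' φ) × (_⊨_ 𝕄' s' φ → _⊨_ 𝕄 s φ)
proposition3p1 _ _ _ _ = invariance
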